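{- Let $A$ be a $p$-torsion free ring equipped with a $p$-derivation $\delta$, with associated ring endomorphism $\phi(y)=y^p+p\delta y$, and let $I\subset A$ be an ideal with $\delta(I)\subset I$. Then for every $\nu\ge0$: 1) $\delta(I^{[p^\nu]})\subset I^{[p^\nu]}$; 2) $\phi(I^{[p^\nu]})\subset I^{[p^{\nu+1}]}$.
   Context: $p$ is an odd prime. A $p$-derivation on a ring $A$ is a map $\delta:A\to A$ with $\delta(x+y)=\delta x+\delta y+(x^p+y^p-(x+y)^p)/p$ and $\delta(xy)=x^p\delta y+y^p\delta x+p\,\delta x\,\delta y$. For an ideal $I$ and $\nu\ge0$, $I^{[p^\nu]}$ is the ideal generated by all $p^if^{p^j}$ with $f\in I$, $i,j\ge0$, $i+j=\nu$. -}

module Defs where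

open import Level using (Level; _⊔_; suc)
open import Algebra.Bundles using (CommutativeRing; Semiring)
import Algebra.Definitions.RawSemiring as RS
open import Data.Nat as ℕ using (ℕ; zero; NonZero) renaming (suc to 1+)
open import Data.Nat.DivMod using (_/_)
open import Data.Nat.Combinatorics using (_C_)
open import Data.Nat.Primality using (Prime; prime⇒nonZero)
open import Data.Product using (Σ; _×_; ∃; ∃-syntax)
open import Relation.Binary.PropositionalEquality using (_≡_)
open import Relation.Unary using (Pred; _∈_)

module _ {c ℓ : Level} (R : CommutativeRing c ℓ) where
  open CommutativeRing R renaming (Carrier to A)
  open RS (Semiring.rawSemiring semiring) using (_^_) renaming (_×_ to _·_)

  TorsionFree : ℕ → Set (c ⊔ ℓ)
  TorsionFree p = ∀ x → (p · x) ≈ 0# → x ≈ 0#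

  -- C_p(x,y) = (x^p + y^p - (x+y)^p)/p
  --          = - Σ_{k=1}^{p-1} (binom(p,k)/p) x^k y^(p-k),
  -- a polynomial with integer coefficients.
  module _ (p : ℕ) .{{_ : NonZero p}} where
    Cterm : A → A → ℕ → A
    Cterm x y k = ((p C k) / p) · ((x ^ k) * (y ^ (p ℕ.∸ k)))

    Csum : A → A → ℕ → A
    Csum x y zero   = 0#
    Csum x y (1+ n) = Csum x y n + Cterm x y (1+ n)

    Cp : A → A → A
    Cp x y = - Csum x y (p ℕ.∸ 1)

  record IsPDerivation (p : ℕ) (pr : Prime p) (δ : A → A) : Set (c ⊔ ℓ) where
    private instance _ = prime⇒nonZero pr
    field
      δ-cong : ∀ {x y} → x ≈ y → δ x ≈ δ y
      δ-add  : ∀ x y → δ (x + y) ≈ (δ x + δ y) + Cp p x y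
      δ-mul  : ∀ x y → δ (x * y) ≈ ((x ^ p) * δ y + (y ^ p) * δ x) + p · (δ x * δ y)

  φ : ℕ → (A → A) → A → A
  φ p δ y = (y ^ p) + p · δ y

  record IsIdeal {ℓI : Level} (I : Pred A ℓI) : Set (c ⊔ ℓ ⊔ ℓI) where
    field
      ∈-resp-≈ : ∀ {x y} → x ≈ y → x ∈ I → y ∈ I
      0∈       : 0# ∈ I
      +-closed : ∀ {x y} → x ∈ I → y ∈ I → (x + y) ∈ I
      *-closed : ∀ a {x} → x ∈ I → (a * x) ∈ I

  data Generated {ℓS : Level} (S : Pred A ℓS) : Pred A (c ⊔ ℓ ⊔ ℓS) where
    gen  : ∀ {x} → x ∈ S → Generated S x
    zer  : Generated S 0#
    add  : ∀ {x y} → Generated S x → Generated S y → Generated S (x + y)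
    mul  : ∀ a {x} → Generated S x → Generated S (a * x)
    resp : ∀ {x y} → x ≈ y → Generated S x → Generated S y

  FrobGens : {ℓI : Level} → ℕ → Pred A ℓI → ℕ → Pred A (c ⊔ ℓ ⊔ ℓI)
  FrobGens p I ν x =
    ∃[ i ] ∃[ j ] ∃[ f ] ((i ℕ.+ j ≡ ν) × (f ∈ I) × (x ≈ ((p ℕ.^ i) · (f ^ (p ℕ.^ j)))))

  FrobPow : {ℓI : Level} → ℕ → Pred A ℓI → ℕ → Pred A (c ⊔ ℓ ⊔ ℓI)
  FrobPow p I ν = Generated (FrobGens p I ν)

module Submission where

-- The proof rests on three general facts about ideals ⟨S⟩ generated by a set S.
--   * Since C_p(x,y) ∈ ⟨x⟩, the sum and product rules for δ show that
--     δ(⟨S⟩) ⊆ ⟨S⟩ as soon as δ maps the generators S into ⟨S⟩.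
--   * By the binomial theorem (x+y)^p = x^p + y^p - p·C_p(x,y); hence
--     x ↦ x^p maps ⟨S⟩ into ⟨T⟩ once it does so on S and p·⟨S⟩ ⊆ ⟨T⟩.
--   * φ is additive, so φ(p·u) = p·φ(u); torsion-freeness then gives
--     δ(p·u) = φ(u) - (p·u)^(p-1)·u.
-- With these, p·J_ν ⊆ J_{ν+1} and J_ν^p ⊆ J_{ν+1} are checked on generators,
-- and δ(J_ν) ⊆ J_ν is proved by induction on ν: a generator of J_{ν+1} is
-- either g^p with g ∈ J_ν (product rule) or p·u with u ∈ J_ν (formula above,
-- using φ(u) = u^p + p·δ(u) ∈ J_{ν+1}).

open import Defs
open import Level using (Level)
open import Algebra.Bundles using (CommutativeRing)
open import Data.Nat using (ℕ; suc)
open import Data.Nat.Divisibility using (_∣_)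
open import Data.Nat.Primality using (Prime)
open import Data.Product using (_×_)
open import Relation.Nullary using (¬_)
open import Relation.Unary using (Pred; _∈_)

open import Algebra.Bundles using (Semiring)
import Algebra.Definitions.RawSemiring as RawSemiring
open import Data.Nat as ℕ using (zero; _<_; _≤_; _!; z<s; s≤s)
import Data.Nat.Properties as ℕP
open import Data.Nat.Divisibility using (∣1⇒≡1; ∣⇒≤; m∣m*n)
open import Data.Nat.DivMod using (m*[n/m]≡n)
open import Data.Nat.Combinatorics using (_C_; nCn≡1; k![n∸k]!∣n!)
open import Data.Nat.Combinatorics.Specification using (nCk≡n!/k![n-k]!)
open import Data.Nat.Primality using (euclidsLemma; ¬prime[0]; ¬prime[1])
open import Data.Fin using (toℕ)
open import Data.Product using (_,_)
open import Data.Sum using (inj₁; inj₂)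
open import Data.Empty using (⊥-elim)
open import Relation.Nullary using (contradiction)
open import Relation.Binary.PropositionalEquality as Eq using (_≡_; cong; subst)

n∣n! : ∀ {n} → 0 < n → n ∣ n !
n∣n! {suc n} _ = m∣m*n (n !)

module BinomialDivisibility {p : ℕ} (pr : Prime p) where

  p∤n! : ∀ n → n < p → ¬ (p ∣ n !)
  p∤n! zero    _   p∣1  = ¬prime[1] (subst Prime (∣1⇒≡1 p∣1) pr)
  p∤n! (suc n) n<p p∣n! with euclidsLemma (suc n) (n !) pr p∣n!
  ... | inj₁ p∣1+n = ℕP.<⇒≱ n<p (∣⇒≤ p∣1+n)
  ... | inj₂ p∣n!  = p∤n! n (ℕP.<-trans (ℕP.n<1+n n) n<p) p∣n!

  -- p divides p! = k! (p-k)! (p choose k), but neither k! nor (p-k)!.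
  p∣pCk : ∀ {k} → 0 < k → k < p → p ∣ p C k
  p∣pCk {k} 0<k k<p with euclidsLemma (k ! ℕ.* (p ℕ.∸ k) !) (p C k) pr p∣product
    where
    k≤p = ℕP.<⇒≤ k<p
    instance _ = k ℕP.!* (p ℕ.∸ k) !≢0
    p!-factorisation : (k ! ℕ.* (p ℕ.∸ k) !) ℕ.* (p C k) ≡ p !
    p!-factorisation = Eq.trans (cong ((k ! ℕ.* (p ℕ.∸ k) !) ℕ.*_) (nCk≡n!/k![n-k]! k≤p))
                                (m*[n/m]≡n (k![n∸k]!∣n! k≤p))
    p∣product : p ∣ (k ! ℕ.* (p ℕ.∸ k) !) ℕ.* (p C k)
    p∣product = subst (p ∣_) (Eq.sym p!-factorisation) (n∣n! (ℕP.<-trans 0<k k<p))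
  ... | inj₂ p∣pCk = p∣pCk
  ... | inj₁ p∣k![p-k]! with euclidsLemma (k !) ((p ℕ.∸ k) !) pr p∣k![p-k]!
  ...   | inj₁ p∣k!     = contradiction p∣k! (p∤n! k k<p)
  ...   | inj₂ p∣[p-k]! =
    contradiction p∣[p-k]! (p∤n! (p ℕ.∸ k) (ℕP.∸-monoʳ-< 0<k (ℕP.<⇒≤ k<p)))

module Theory {c ℓ : Level} (R : CommutativeRing c ℓ) where

  open CommutativeRing R renaming (Carrier to A)
  open RawSemiring (Semiring.rawSemiring semiring) using (_^_; sum) renaming (_×_ to _·_)
  open import Algebra.Properties.Semiring.Mult semiring
    using (×-congˡ; ×-congʳ; ×-homo-1; ×-assocˡ; ×-assoc-*; ×-comm-*)
  open import Algebra.Properties.CommutativeMonoid.Mult +-commutativeMonoid using (×-distrib-+)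
  open import Algebra.Properties.Semiring.Exp semiring using (^-congˡ; ^-congʳ; ^-assocʳ)
  open import Algebra.Properties.CommutativeSemiring.Exp commutativeSemiring using (^-distrib-*)
  import Algebra.Properties.CommutativeSemiring.Binomial commutativeSemiring as Binomial
  import Algebra.Properties.CommutativeSemigroup +-commutativeSemigroup as +-CS
  open import Algebra.Properties.AbelianGroup +-abelianGroup
    using (xyx⁻¹≈y; identityʳ-unique; inverseˡ-unique; x∙y⁻¹≈ε⇒x≈y; x≈y⇒x∙y⁻¹≈ε)
  open import Algebra.Properties.Ring ring using (-1*x≈-x)
  open import Relation.Binary.Reasoning.Setoid setoid

  x+y≈z⇒y≈z-x : ∀ {x y z} → x + y ≈ z → y ≈ z - x
  x+y≈z⇒y≈z-x {x} {y} x+y≈z = trans (sym (xyx⁻¹≈y x y)) (+-congʳ x+y≈z)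

  x+y≈z⇒x≈z-y : ∀ {x y z} → x + y ≈ z → x ≈ z - y
  x+y≈z⇒x≈z-y {x} {y} x+y≈z = x+y≈z⇒y≈z-x (trans (+-comm y x) x+y≈z)

  ·-zeroʳ : ∀ n → n · 0# ≈ 0#
  ·-zeroʳ zero    = refl
  ·-zeroʳ (suc n) = trans (+-identityˡ _) (·-zeroʳ n)

  ·-neg : ∀ n x → n · (- x) ≈ - (n · x)
  ·-neg n x = inverseˡ-unique _ _ (begin
    n · (- x) + n · x ≈⟨ ×-distrib-+ (- x) x n ⟨
    n · (- x + x)     ≈⟨ ×-congʳ n (-‿inverseˡ x) ⟩
    n · 0#            ≈⟨ ·-zeroʳ n ⟩
    0#                ∎)

  ·-sub : ∀ n x y → n · (x - y) ≈ n · x - n · y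
  ·-sub n x y = trans (×-distrib-+ x (- y) n) (+-congˡ (·-neg n y))

  ·-*-· : ∀ a b x y → (a · x) * (b · y) ≈ (a ℕ.* b) · (x * y)
  ·-*-· a b x y = begin
    (a · x) * (b · y)   ≈⟨ ×-assoc-* a x (b · y) ⟩
    a · (x * (b · y))   ≈⟨ ×-congʳ a (×-comm-* b x y) ⟩
    a · (b · (x * y))   ≈⟨ ×-assocˡ (x * y) a b ⟩
    (a ℕ.* b) · (x * y) ∎

  ·-^ : ∀ k x n → (k · x) ^ n ≈ (k ℕ.^ n) · (x ^ n)
  ·-^ k x zero    = sym (×-homo-1 1#)
  ·-^ k x (suc n) = trans (*-congˡ (·-^ k x n)) (·-*-· k (k ℕ.^ n) x (x ^ n))

  ·-cancel : ∀ {p} → TorsionFree R p → ∀ {x y} → p · x ≈ p · y → x ≈ y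
  ·-cancel {p} tf {x} {y} px≈py = x∙y⁻¹≈ε⇒x≈y x y (tf (x - y) (begin
    p · (x - y)     ≈⟨ ·-sub p x y ⟩
    p · x - p · y   ≈⟨ x≈y⇒x∙y⁻¹≈ε px≈py ⟩
    0#              ∎))

  -- Finite sums Σ_{k<n} g(k), split off at the first term as the library's
  -- vector sums are; used to read off the binomial expansion term by term.
  ∑< : ℕ → (ℕ → A) → A
  ∑< zero    g = 0#
  ∑< (suc n) g = g 0 + ∑< n (λ k → g (suc k))

  sum≈∑< : ∀ n (g : ℕ → A) → sum {n} (λ i → g (toℕ i)) ≈ ∑< n g
  sum≈∑< zero    g = refl
  sum≈∑< (suc n) g = +-congˡ (sum≈∑< n (λ k → g (suc k)))

  ∑<-last : ∀ n (g : ℕ → A) → ∑< (suc n) g ≈ ∑< n g + g n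
  ∑<-last zero    g = trans (+-identityʳ _) (sym (+-identityˡ _))
  ∑<-last (suc n) g = trans (+-congˡ (∑<-last n (λ k → g (suc k)))) (sym (+-assoc _ _ _))

  module _ {ℓS : Level} {S : Pred A ℓS} where

    private
      ⟨S⟩ : Pred A _
      ⟨S⟩ = Generated R S

    gen-mulʳ : ∀ {x} a → ⟨S⟩ x → ⟨S⟩ (x * a)
    gen-mulʳ a x∈ = resp (*-comm a _) (mul a x∈)

    gen-neg : ∀ {x} → ⟨S⟩ x → ⟨S⟩ (- x)
    gen-neg x∈ = resp (-1*x≈-x _) (mul (- 1#) x∈)

    gen-sub : ∀ {x y} → ⟨S⟩ x → ⟨S⟩ y → ⟨S⟩ (x - y)
    gen-sub x∈ y∈ = add x∈ (gen-neg y∈)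

    gen-· : ∀ n {x} → ⟨S⟩ x → ⟨S⟩ (n · x)
    gen-· zero    x∈ = zer
    gen-· (suc n) x∈ = add x∈ (gen-· n x∈)

    gen-^ : ∀ k {x} → ⟨S⟩ x → ⟨S⟩ (x ^ suc k)
    gen-^ k {x} x∈ = gen-mulʳ (x ^ k) x∈

    -- Every term of C_p(x,y) contains a positive power of x, so C_p(x,y) ∈ ⟨x⟩.
    gen-Csum : ∀ p .{{_ : ℕ.NonZero p}} {x} y n → ⟨S⟩ x → ⟨S⟩ (Csum R p x y n)
    gen-Csum p y zero    x∈ = zer
    gen-Csum p y (suc n) x∈ =
      add (gen-Csum p y n x∈)
          (gen-· ((p C suc n) ℕ./ p) (gen-mulʳ (y ^ (p ℕ.∸ suc n)) (gen-^ n x∈)))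

    gen-Cp : ∀ p .{{_ : ℕ.NonZero p}} {x} y → ⟨S⟩ x → ⟨S⟩ (Cp R p x y)
    gen-Cp p y x∈ = gen-neg (gen-Csum p y (p ℕ.∸ 1) x∈)

    gen-·-into : ∀ {ℓT} {T : Pred A ℓT} k → (∀ {x} → S x → Generated R T (k · x))
               → ∀ {x} → ⟨S⟩ x → Generated R T (k · x)
    gen-·-into k k·S (gen s)        = k·S s
    gen-·-into k k·S zer            = resp (sym (·-zeroʳ k)) zer
    gen-·-into k k·S (add x∈ y∈)    =
      resp (sym (×-distrib-+ _ _ k)) (add (gen-·-into k k·S x∈) (gen-·-into k k·S y∈))
    gen-·-into k k·S (mul a x∈)     = resp (×-comm-* k a _) (mul a (gen-·-into k k·S x∈))
    gen-·-into k k·S (resp x≈y x∈)  = resp (×-congʳ k x≈y) (gen-·-into k k·S x∈)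

  module _ (m : ℕ) (pr : Prime (suc (suc m))) where

    p : ℕ
    p = suc (suc m)

    open BinomialDivisibility pr using (p∣pCk)

    binomial : ∀ x y → (x + y) ^ p + p · Cp R p x y ≈ x ^ p + y ^ p
    binomial x y = begin
      (x + y) ^ p + p · Cp R p x y
        ≈⟨ +-cong (Binomial.theorem p x y) (·-neg p _) ⟩
      Binomial.binomialExpansion x y p - p · Csum R p x y (suc m)
        ≈⟨ +-cong (sum≈∑< (suc p) term) (-‿cong (p·Csum≈∑< (suc m) ℕP.≤-refl)) ⟩
      (term 0 + ∑< (suc (suc m)) inner) - ∑< (suc m) inner
        ≈⟨ +-congʳ (+-congˡ (∑<-last (suc m) inner)) ⟩
      (term 0 + (∑< (suc m) inner + term p)) - ∑< (suc m) inner
        ≈⟨ +-congʳ (+-CS.x∙yz≈y∙zx _ _ _) ⟩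
      (∑< (suc m) inner + (term p + term 0)) - ∑< (suc m) inner
        ≈⟨ xyx⁻¹≈y _ _ ⟩
      term p + term 0
        ≈⟨ +-cong term-p term-0 ⟩
      x ^ p + y ^ p ∎
      where
      term : ℕ → A
      term k = (p C k) · ((x ^ k) * (y ^ (p ℕ.∸ k)))

      inner : ℕ → A
      inner k = term (suc k)

      term-0 : term 0 ≈ y ^ p
      term-0 = trans (×-homo-1 _) (*-identityˡ _)

      term-p : term p ≈ x ^ p
      term-p = begin
        (p C p) · ((x ^ p) * (y ^ (p ℕ.∸ p))) ≈⟨ ×-congˡ (nCn≡1 p) ⟩
        1 · ((x ^ p) * (y ^ (p ℕ.∸ p)))       ≈⟨ ×-homo-1 _ ⟩
        (x ^ p) * (y ^ (p ℕ.∸ p))             ≈⟨ *-congˡ (^-congʳ y (ℕP.n∸n≡0 p)) ⟩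
        (x ^ p) * 1#                          ≈⟨ *-identityʳ _ ⟩
        x ^ p                                 ∎

      -- p·C_p collects the inner terms: the coefficients (p choose k)/p are exact.
      p·Csum≈∑< : ∀ n → n ≤ suc m → p · Csum R p x y n ≈ ∑< n inner
      p·Csum≈∑< zero    _       = ·-zeroʳ p
      p·Csum≈∑< (suc n) 1+n≤1+m = begin
        p · (Csum R p x y n + Cterm R p x y (suc n))
          ≈⟨ ×-distrib-+ _ _ p ⟩
        p · Csum R p x y n + p · Cterm R p x y (suc n)
          ≈⟨ +-cong (p·Csum≈∑< n (ℕP.m+n≤o⇒n≤o 1 1+n≤1+m)) (×-assocˡ _ p ((p C suc n) ℕ./ p)) ⟩
        ∑< n inner + (p ℕ.* ((p C suc n) ℕ./ p)) · ((x ^ suc n) * (y ^ (p ℕ.∸ suc n)))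
          ≈⟨ +-congˡ (×-congˡ (m*[n/m]≡n (p∣pCk z<s (s≤s 1+n≤1+m)))) ⟩
        ∑< n inner + inner n
          ≈⟨ ∑<-last n inner ⟨
        ∑< (suc n) inner ∎

    -- If x^p ∈ ⟨T⟩ for generators x ∈ S and p·⟨S⟩ ⊆ ⟨T⟩, then x^p ∈ ⟨T⟩ for
    -- all x ∈ ⟨S⟩: the p-th power is additive up to the multiple p·C_p(x,y).
    gen-^p : ∀ {ℓS ℓT} {S : Pred A ℓS} {T : Pred A ℓT}
           → (∀ {x} → S x → Generated R T (x ^ p))
           → (∀ {x} → Generated R S x → Generated R T (p · x))
           → ∀ {x} → Generated R S x → Generated R T (x ^ p)
    gen-^p ^p-S p·S (gen s)              = ^p-S s
    gen-^p ^p-S p·S zer                  = resp (sym (zeroˡ _)) zer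
    gen-^p ^p-S p·S (add {x} {y} x∈ y∈)  =
      resp (sym (x+y≈z⇒x≈z-y (binomial x y)))
           (gen-sub (add (gen-^p ^p-S p·S x∈) (gen-^p ^p-S p·S y∈)) (p·S (gen-Cp p y x∈)))
    gen-^p ^p-S p·S (mul a {x} x∈)       =
      resp (sym (^-distrib-* a x p)) (mul (a ^ p) (gen-^p ^p-S p·S x∈))
    gen-^p ^p-S p·S (resp x≈y x∈)        = resp (^-congˡ p x≈y) (gen-^p ^p-S p·S x∈)

    module Derivation (δ : A → A) (isD : IsPDerivation R p pr δ) where

      open IsPDerivation isD

      -- δ(0) = -C_p(0,0), from δ(0) = δ(0 + 0) = 2δ(0) + C_p(0,0); so δ(0) lies in every ideal.
      δ0≈-Cp : δ 0# ≈ - Cp R p 0# 0#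
      δ0≈-Cp = inverseˡ-unique _ _ (identityʳ-unique _ _ (begin
        δ 0# + (δ 0# + Cp R p 0# 0#) ≈⟨ +-assoc _ _ _ ⟨
        (δ 0# + δ 0#) + Cp R p 0# 0# ≈⟨ δ-add 0# 0# ⟨
        δ (0# + 0#)                  ≈⟨ δ-cong (+-identityʳ 0#) ⟩
        δ 0#                         ∎))

      gen-δ : ∀ {ℓS} {S : Pred A ℓS}
            → (∀ {x} → S x → Generated R S (δ x))
            → ∀ {x} → Generated R S x → Generated R S (δ x)
      gen-δ δS (gen s)             = δS s
      gen-δ δS zer                 = resp (sym δ0≈-Cp) (gen-neg (gen-Cp p 0# zer))
      gen-δ δS (add {x} {y} x∈ y∈) =
        resp (sym (δ-add x y)) (add (add (gen-δ δS x∈) (gen-δ δS y∈)) (gen-Cp p y x∈))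
      gen-δ δS (mul a {x} x∈)      =
        resp (sym (δ-mul a x))
          (add (add (mul (a ^ p) (gen-δ δS x∈)) (gen-mulʳ (δ a) (gen-^ (suc m) x∈)))
               (gen-· p (mul (δ a) (gen-δ δS x∈))))
      gen-δ δS (resp x≈y x∈)       = resp (δ-cong x≈y) (gen-δ δS x∈)

      φδ : A → A
      φδ = φ R p δ

      φδ-cong : ∀ {x y} → x ≈ y → φδ x ≈ φδ y
      φδ-cong x≈y = +-cong (^-congˡ p x≈y) (×-congʳ p (δ-cong x≈y))

      φδ-+ : ∀ x y → φδ (x + y) ≈ φδ x + φδ y
      φδ-+ x y = begin
        (x + y) ^ p + p · δ (x + y)
          ≈⟨ +-congˡ (×-congʳ p (δ-add x y)) ⟩
        (x + y) ^ p + p · ((δ x + δ y) + Cp R p x y)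
          ≈⟨ +-congˡ (trans (×-distrib-+ _ _ p) (+-congʳ (×-distrib-+ _ _ p))) ⟩
        (x + y) ^ p + ((p · δ x + p · δ y) + p · Cp R p x y)
          ≈⟨ +-CS.x∙yz≈xz∙y _ _ _ ⟩
        ((x + y) ^ p + p · Cp R p x y) + (p · δ x + p · δ y)
          ≈⟨ +-congʳ (binomial x y) ⟩
        (x ^ p + y ^ p) + (p · δ x + p · δ y)
          ≈⟨ +-CS.interchange _ _ _ _ ⟩
        φδ x + φδ y ∎

      φδ-0 : φδ 0# ≈ 0#
      φδ-0 = identityʳ-unique _ _ (trans (sym (φδ-+ 0# 0#)) (φδ-cong (+-identityʳ 0#)))

      φδ-· : ∀ n x → φδ (n · x) ≈ n · φδ x
      φδ-· zero    x = φδ-0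
      φδ-· (suc n) x = trans (φδ-+ x (n · x)) (+-congˡ (φδ-· n x))

      -- In a p-torsion-free ring, δ(p·u) = φ(u) - (p·u)^(p-1)·u: both sides
      -- become equal after multiplying by p, since φ(p·u) = p·φ(u).
      δ-p· : TorsionFree R p → ∀ u → δ (p · u) ≈ φδ u - ((p · u) ^ suc m) * u
      δ-p· tf u = x+y≈z⇒y≈z-x (·-cancel {p} tf (begin
        p · (X + δ (p · u))          ≈⟨ ×-distrib-+ X _ p ⟩
        p · X + p · δ (p · u)        ≈⟨ +-congʳ (trans (*-comm _ _) (×-comm-* p _ u)) ⟨
        (p · u) ^ p + p · δ (p · u)  ≈⟨ φδ-· p u ⟩
        p · φδ u                     ∎))
        where
        X = ((p · u) ^ suc m) * u

      module FrobeniusIdeals (tf : TorsionFree R p) {ℓI : Level} (I : Pred A ℓI)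
                             (δI : ∀ x → x ∈ I → δ x ∈ I) where

        J : ℕ → Pred A _
        J = FrobPow R p I

        ^p^j-^p : ∀ f j → (f ^ (p ℕ.^ j)) ^ p ≈ f ^ (p ℕ.^ suc j)
        ^p^j-^p f j = trans (^-assocʳ f (p ℕ.^ j) p) (^-congʳ f (ℕP.*-comm (p ℕ.^ j) p))

        J-· : ∀ n {x} → J n x → J (suc n) (p · x)
        J-· n = gen-·-into p p·generator
          where
          p·generator : ∀ {x} → FrobGens R p I n x → J (suc n) (p · x)
          p·generator (i , j , f , i+j≡n , f∈I , x≈) =
            gen (suc i , j , f , cong suc i+j≡n , f∈I ,
                 trans (×-congʳ p x≈) (×-assocˡ (f ^ (p ℕ.^ j)) p (p ℕ.^ i)))

        -- (J n)^p ⊆ J (n+1), since (p^i f^(p^j))^p = (p^i)^(p-1) · p^i f^(p^(j+1)).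
        J-^p : ∀ n {x} → J n x → J (suc n) (x ^ p)
        J-^p n = gen-^p generator^p (J-· n)
          where
          generator^p : ∀ {x} → FrobGens R p I n x → J (suc n) (x ^ p)
          generator^p (i , j , f , i+j≡n , f∈I , x≈) =
            resp (sym x^p≈) (gen-· (k ℕ.^ suc m)
              (gen (i , suc j , f , Eq.trans (ℕP.+-suc i j) (cong suc i+j≡n) , f∈I , refl)))
            where
            k = p ℕ.^ i
            w = f ^ (p ℕ.^ j)
            x^p≈ : _ ≈ (k ℕ.^ suc m) · (k · (f ^ (p ℕ.^ suc j)))
            x^p≈ = begin
              _ ^ p                               ≈⟨ ^-congˡ p x≈ ⟩
              (k · w) ^ p                         ≈⟨ ·-^ k w p ⟩
              (k ℕ.^ p) · (w ^ p)                 ≈⟨ ×-congˡ (ℕP.*-comm k (k ℕ.^ suc m)) ⟩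
              (k ℕ.^ suc m ℕ.* k) · (w ^ p)       ≈⟨ ×-assocˡ (w ^ p) (k ℕ.^ suc m) k ⟨
              (k ℕ.^ suc m) · (k · (w ^ p))
                ≈⟨ ×-congʳ (k ℕ.^ suc m) (×-congʳ k (^p^j-^p f j)) ⟩
              (k ℕ.^ suc m) · (k · (f ^ (p ℕ.^ suc j))) ∎

        J-φδ : ∀ n {x} → J n x → J n (δ x) → J (suc n) (φδ x)
        J-φδ n x∈ δx∈ = add (J-^p n x∈) (J-· n δx∈)

        -- δ(g^p) ∈ J (n+1) when g, δ(g) ∈ J n, by the product rule for g · g^(p-1).
        J-δ-^p : ∀ n {g} → J n g → J n (δ g) → J (suc n) (δ (g ^ p))
        J-δ-^p n {g} g∈ δg∈ =
          resp (sym (δ-mul g h))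
            (add (add (gen-mulʳ (δ h) (J-^p n g∈)) (gen-mulʳ (δ g) (J-^p n (gen-^ m g∈))))
                 (resp (×-assoc-* p (δ g) (δ h)) (gen-mulʳ (δ h) (J-· n δg∈))))
          where
          h = g ^ suc m

        -- δ(p·u) ∈ J (n+1) when u, δ(u) ∈ J n, by δ(p·u) = φ(u) - (p·u)^(p-1)·u.
        J-δ-p· : ∀ n {u} → J n u → J n (δ u) → J (suc n) (δ (p · u))
        J-δ-p· n {u} u∈ δu∈ =
          resp (sym (δ-p· tf u)) (gen-sub (J-φδ n u∈ δu∈) (gen-mulʳ u (gen-^ m (J-· n u∈))))

        -- The generators of J 0 are (up to 1·f^1 ≈ f) the elements of I.
        δ-generator₀ : ∀ {x} → FrobGens R p I 0 x → J 0 (δ x)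
        δ-generator₀ (zero , zero , f , _ , f∈I , x≈) =
          resp (δ-cong (sym (trans x≈ (1·x¹≈x f))))
               (gen (0 , 0 , δ f , Eq.refl , δI f f∈I , sym (1·x¹≈x (δ f))))
          where
          1·x¹≈x : ∀ x → 1 · (x ^ 1) ≈ x
          1·x¹≈x x = trans (×-homo-1 _) (*-identityʳ x)

        -- A generator of J (n+1) is g^p with g = f^(p^n) ∈ J n, or p·u with u ∈ J n.
        δ-generator-suc : ∀ n → (∀ {x} → J n x → J n (δ x))
                        → ∀ {x} → FrobGens R p I (suc n) x → J (suc n) (δ x)
        δ-generator-suc n δJ (zero , j , f , Eq.refl , f∈I , x≈) =
          resp (δ-cong (sym (trans x≈ (trans (×-homo-1 _) (sym (^p^j-^p f n))))))
               (J-δ-^p n g∈ (δJ g∈))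
          where
          g∈ : J n (f ^ (p ℕ.^ n))
          g∈ = gen (0 , n , f , Eq.refl , f∈I , sym (×-homo-1 _))
        δ-generator-suc n δJ (suc i , j , f , 1+i+j≡1+n , f∈I , x≈) =
          resp (δ-cong (sym (trans x≈ (sym (×-assocˡ _ p (p ℕ.^ i))))))
               (J-δ-p· n u∈ (δJ u∈))
          where
          u∈ : J n ((p ℕ.^ i) · (f ^ (p ℕ.^ j)))
          u∈ = gen (i , j , f , ℕP.suc-injective 1+i+j≡1+n , f∈I , refl)

        J-δ-closed : ∀ n {x} → J n x → J n (δ x)
        J-δ-closed zero    = gen-δ δ-generator₀
        J-δ-closed (suc n) = gen-δ (δ-generator-suc n (J-δ-closed n))

        J-φδ-closed : ∀ n {x} → J n x → J (suc n) (φδ x)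
        J-φδ-closed n x∈ = J-φδ n x∈ (J-δ-closed n x∈)

-- A prime has the form m + 2.
lemma3p2 : ∀ {c ℓ ℓI : Level} (R : CommutativeRing c ℓ) (p : ℕ) (pr : Prime p) → ¬ (2 ∣ p)
    → TorsionFree R p
    → (δ : CommutativeRing.Carrier R → CommutativeRing.Carrier R) → IsPDerivation R p pr δ
    → (I : Pred (CommutativeRing.Carrier R) ℓI) → IsIdeal R I
    → (∀ x → x ∈ I → δ x ∈ I)
    → ∀ (ν : ℕ)
    → (∀ x → x ∈ FrobPow R p I ν → δ x ∈ FrobPow R p I ν)
    × (∀ x → x ∈ FrobPow R p I ν → φ R p δ x ∈ FrobPow R p I (suc ν))
lemma3p2 R zero          pr = ⊥-elim (¬prime[0] pr)
lemma3p2 R (suc zero)    pr = ⊥-elim (¬prime[1] pr)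
lemma3p2 R (suc (suc m)) pr _ tf δ isD I _ δI ν = (λ _ → J-δ-closed ν) , (λ _ → J-φδ-closed ν)
  where
  open Theory.Derivation.FrobeniusIdeals R m pr δ isD tf I δI using (J-δ-closed; J-φδ-closed)
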